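{- For integers $n\ge1$ and $m>1$, $$G_{n,1,0}^{m,0,2}=G_{n,1,0}^{m-1,0,2}-\frac{1}{m(m-1)^{2}}-\frac{H_{n+1,2}}{m-1}+\frac{H_{m,1}}{(m-1)^{2}}+\frac{H_{n+1,2}}{n+m}-\frac{1}{(m-1)^{2}}\sum_{j=n+2}^{n+m}\frac{1}{j},$$ and for $m=1$, $$G_{n,1,0}^{1,0,2}=\sum_{j=1}^{n}\frac{H_{j,2}}{j+1}=H_{n+1,1}H_{n+1,2}-\sum_{j=1}^{n+1}\frac{H_{j,1}}{j^{2}}.$$
   Context: $H_{j,m}=\sum_{i=1}^{j}i^{ -m}$. $G_{n,1,0}^{m,0,2}=\sum_{j=1}^{n}\frac{H_{j,2}}{j+m}$ for integers $m\ge0$. -}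

module Defs where

open import Data.Nat using (ℕ; zero; suc; _∸_) renaming (_+_ to _+ℕ_)
open import Data.Integer using (+_)
open import Data.Rational using (ℚ; 0ℚ; _/_; _+_; _*_; _-_)

-- 1 / k as a rational, for k ≥ 1 (convention: inv 0 = 0; never used at 0 below)
inv : ℕ → ℚ
inv zero    = 0ℚ
inv (suc k) = (+ 1) / suc k

invPow : ℕ → ℕ → ℚ
invPow k zero    = (+ 1) / 1
invPow k (suc m) = inv k * invPow k m

sum1 : ℕ → (ℕ → ℚ) → ℚ
sum1 zero    f = 0ℚ
sum1 (suc n) f = sum1 n f + f (suc n)

-- Σ_{j=a}^{b} f j   (empty, i.e. 0, when b < a)
sumFromTo : ℕ → ℕ → (ℕ → ℚ) → ℚ
sumFromTo a b f = sum1 (suc b ∸ a) (λ i → f ((a ∸ 1) +ℕ i))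

H : ℕ → ℕ → ℚ
H j m = sum1 j (λ i → invPow i m)

-- G_{n,1,0}^{m,0,2} = Σ_{j=1}^{n} H_{j,2} / (j+m)
G : ℕ → ℕ → ℚ
G n m = sum1 n (λ j → H j 2 * inv (j +ℕ m))

-- Both identities are proved by induction on n, starting from n = 0 where G vanishes. For m > 1, put a = 1/(n+2), b = 1/(m−1), e = 1/(n+m+1):
-- the inductive step reduces to a²(e − b) = b²(e − a), which follows from the partial fraction
-- identity (a + b) e = a b, and the same identity with a = 1 gives the base case. For m = 1 the
-- step is summation by parts: H_{n+2,1} H_{n+2,2} − H_{n+1,1} H_{n+1,2} − H_{n+2,1}/(n+2)²
-- = H_{n+1,2}/(n+2).

module Submission where

open import Data.Nat as ℕ using (ℕ; zero; suc; _∸_; _≤_; _<_; s≤s; z≤n)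
  renaming (_+_ to _+ℕ_; _*_ to _*ℕ_)
import Data.Nat.Properties as ℕ
open import Data.Nat.Coprimality using (1-coprimeTo) renaming (sym to coprime-sym)
open import Data.Integer as ℤ using (1ℤ)
open import Data.Integer.Tactic.RingSolver using (solve-∀)
open import Data.Rational using (ℚ; mkℚ; 0ℚ; 1ℚ; _+_; _*_; _-_; toℚᵘ)
open import Data.Rational.Properties
open import Data.Rational.Solver using (module +-*-Solver)
import Data.Rational.Unnormalised as ℚᵘ using (*≡*)
import Data.Rational.Unnormalised.Properties as ℚᵘ
open import Data.Product using (_×_; _,_)
open import Relation.Binary.PropositionalEquality
open import Defs

open +-*-Solver
open ≡-Reasoning

fromℕ : ℕ → ℚ
fromℕ k = mkℚ (ℤ.+ k) 0 (coprime-sym (1-coprimeTo k))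

fromℕ-suc : ∀ k → fromℕ (suc k) ≡ 1ℚ + fromℕ k
fromℕ-suc k =
  toℚᵘ-injective (ℚᵘ.≃-trans (ℚᵘ.*≡* (cross (ℤ.+ k))) (ℚᵘ.≃-sym (toℚᵘ-homo-+ 1ℚ (fromℕ k))))
  where
  cross : ∀ x → (1ℤ ℤ.+ x) ℤ.* (1ℤ ℤ.* 1ℤ) ≡ (1ℤ ℤ.* 1ℤ ℤ.+ x ℤ.* 1ℤ) ℤ.* 1ℤ
  cross = solve-∀

fromℕ-+ : ∀ a b → fromℕ (a +ℕ b) ≡ fromℕ a + fromℕ b
fromℕ-+ zero    b = sym (+-identityˡ (fromℕ b))
fromℕ-+ (suc a) b = begin
  fromℕ (suc (a +ℕ b))      ≡⟨ fromℕ-suc (a +ℕ b) ⟩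
  1ℚ + fromℕ (a +ℕ b)       ≡⟨ cong (1ℚ +_) (fromℕ-+ a b) ⟩
  1ℚ + (fromℕ a + fromℕ b)  ≡⟨ +-assoc 1ℚ (fromℕ a) (fromℕ b) ⟨
  1ℚ + fromℕ a + fromℕ b    ≡⟨ cong (_+ fromℕ b) (fromℕ-suc a) ⟨
  fromℕ (suc a) + fromℕ b   ∎

fromℕ-* : ∀ a b → fromℕ (a *ℕ b) ≡ fromℕ a * fromℕ b
fromℕ-* zero    b = sym (*-zeroˡ (fromℕ b))
fromℕ-* (suc a) b = begin
  fromℕ (b +ℕ a *ℕ b)          ≡⟨ fromℕ-+ b (a *ℕ b) ⟩
  fromℕ b + fromℕ (a *ℕ b)     ≡⟨ cong (fromℕ b +_) (fromℕ-* a b) ⟩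
  fromℕ b + fromℕ a * fromℕ b  ≡⟨ solve 2 (λ x y → y :+ x :* y := (con 1ℚ :+ x) :* y) refl (fromℕ a) (fromℕ b) ⟩
  (1ℚ + fromℕ a) * fromℕ b     ≡⟨ cong (_* fromℕ b) (fromℕ-suc a) ⟨
  fromℕ (suc a) * fromℕ b      ∎

inv-inverse : ∀ k .{{_ : ℕ.NonZero k}} → inv k * fromℕ k ≡ 1ℚ
inv-inverse (suc k) =
  trans (cong (_* fromℕ (suc k)) (normalize-coprime (1-coprimeTo (suc k))))
        (*-inverseˡ (fromℕ (suc k)))

*-inverse-unique : ∀ {x y a} → x * a ≡ 1ℚ → y * a ≡ 1ℚ → x ≡ y
*-inverse-unique {x} {y} {a} xa≡1 ya≡1 = begin
  x            ≡⟨ *-identityʳ x ⟨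
  x * 1ℚ       ≡⟨ cong (x *_) ya≡1 ⟨
  x * (y * a)  ≡⟨ solve 3 (λ x y a → x :* (y :* a) := y :* (x :* a)) refl x y a ⟩
  y * (x * a)  ≡⟨ cong (y *_) xa≡1 ⟩
  y * 1ℚ       ≡⟨ *-identityʳ y ⟩
  y            ∎

inv-* : ∀ a b .{{_ : ℕ.NonZero a}} .{{_ : ℕ.NonZero b}} → inv (a *ℕ b) ≡ inv a * inv b
inv-* a@(suc _) b@(suc _) = *-inverse-unique (inv-inverse (a *ℕ b)) (begin
  inv a * inv b * fromℕ (a *ℕ b)            ≡⟨ cong (inv a * inv b *_) (fromℕ-* a b) ⟩
  inv a * inv b * (fromℕ a * fromℕ b)       ≡⟨ solve 4 (λ x y X Y → x :* y :* (X :* Y) := x :* X :* (y :* Y)) refl (inv a) (inv b) (fromℕ a) (fromℕ b) ⟩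
  inv a * fromℕ a * (inv b * fromℕ b)       ≡⟨ cong₂ _*_ (inv-inverse a) (inv-inverse b) ⟩
  1ℚ * 1ℚ                                   ∎)

inv-+ : ∀ a b .{{_ : ℕ.NonZero a}} .{{_ : ℕ.NonZero b}} →
        (inv a + inv b) * inv (a +ℕ b) ≡ inv a * inv b
inv-+ a@(suc _) b@(suc _) = begin
  (x + y) * e                    ≡⟨ cong (λ t → t * e) (cong₂ _+_ (rescale x (inv-inverse b)) (rescale y (inv-inverse a))) ⟩
  (x * (y * Y) + y * (x * X)) * e  ≡⟨ solve 5 (λ x y X Y e → (x :* (y :* Y) :+ y :* (x :* X)) :* e := x :* y :* (e :* (X :+ Y))) refl x y X Y e ⟩
  x * y * (e * (X + Y))          ≡⟨ cong (λ t → x * y * (e * t)) (fromℕ-+ a b) ⟨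
  x * y * (e * fromℕ (a +ℕ b))   ≡⟨ cong (x * y *_) (inv-inverse (a +ℕ b)) ⟩
  x * y * 1ℚ                     ≡⟨ *-identityʳ (x * y) ⟩
  x * y                          ∎
  where
  x = inv a; y = inv b; e = inv (a +ℕ b); X = fromℕ a; Y = fromℕ b
  rescale : ∀ z {u} → u ≡ 1ℚ → z ≡ z * u
  rescale z u≡1 = sym (trans (cong (z *_) u≡1) (*-identityʳ z))

squares-of-partial-fraction : ∀ x y e → (x + y) * e ≡ x * y → x * x * (e - y) ≡ y * y * (e - x)
squares-of-partial-fraction x y e eq = begin
  x * x * (e - y)                                      ≡⟨ solve 3 (λ x y e → x :* x :* (e :- y) := y :* y :* (e :- x) :+ (x :- y) :* ((x :+ y) :* e :- x :* y)) refl x y e ⟩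
  y * y * (e - x) + (x - y) * ((x + y) * e - x * y)    ≡⟨ cong (λ t → y * y * (e - x) + (x - y) * (t - x * y)) eq ⟩
  y * y * (e - x) + (x - y) * (x * y - x * y)          ≡⟨ solve 3 (λ x y e → y :* y :* (e :- x) :+ (x :- y) :* (x :* y :- x :* y) := y :* y :* (e :- x)) refl x y e ⟩
  y * y * (e - x)                                      ∎

inv²-partial-fraction : ∀ a b .{{_ : ℕ.NonZero a}} .{{_ : ℕ.NonZero b}} →
  inv a * inv a * (inv (a +ℕ b) - inv b) ≡ inv b * inv b * (inv (a +ℕ b) - inv a)
inv²-partial-fraction a b = squares-of-partial-fraction (inv a) (inv b) (inv (a +ℕ b)) (inv-+ a b)

+-cancel-difference : ∀ z {x y} → x ≡ y → z + (x - y) ≡ z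
+-cancel-difference z {x} {y} refl = solve 2 (λ z x → z :+ (x :- x) := z) refl z x

sum1-cong : ∀ n {f g : ℕ → ℚ} → (∀ i → f i ≡ g i) → sum1 n f ≡ sum1 n g
sum1-cong zero    f≗g = refl
sum1-cong (suc n) f≗g = cong₂ _+_ (sum1-cong n f≗g) (f≗g (suc n))

sum1-shift : ∀ n (f : ℕ → ℚ) → sum1 n (λ i → f (suc i)) + f 1 ≡ sum1 n f + f (suc n)
sum1-shift zero    f = refl
sum1-shift (suc n) f = begin
  sum1 n (λ i → f (suc i)) + f (suc (suc n)) + f 1  ≡⟨ solve 3 (λ s u v → s :+ u :+ v := s :+ v :+ u) refl (sum1 n (λ i → f (suc i))) (f (suc (suc n))) (f 1) ⟩
  sum1 n (λ i → f (suc i)) + f 1 + f (suc (suc n))  ≡⟨ cong (_+ f (suc (suc n))) (sum1-shift n f) ⟩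
  sum1 n f + f (suc n) + f (suc (suc n))            ∎

sum1-unique : ∀ (F g : ℕ → ℚ) → F 0 ≡ 0ℚ → (∀ n → F (suc n) ≡ F n + g (suc n)) →
              ∀ n → sum1 n g ≡ F n
sum1-unique F g F0 Fsuc zero    = sym F0
sum1-unique F g F0 Fsuc (suc n) = trans (cong (_+ g (suc n)) (sum1-unique F g F0 Fsuc n)) (sym (Fsuc n))

sumFromTo-suc : ∀ a l (f : ℕ → ℚ) → sumFromTo (suc a) (a +ℕ l) f ≡ sum1 l (λ i → f (a +ℕ i))
sumFromTo-suc a l f = cong (λ c → sum1 c (λ i → f (a +ℕ i))) (ℕ.m+n∸m≡n a l)

-- The case m = k + 2, with b = 1/(m − 1) and tail n = Σ_{j=n+2}^{n+m} 1/j.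
module Recurrence (k : ℕ) where

  b : ℚ
  b = inv (suc k)

  tail : ℕ → ℚ
  tail n = sum1 (suc k) (λ i → inv (suc n +ℕ i))

  rhs : ℕ → ℚ
  rhs n = G n (suc k) - inv (suc (suc k)) * (b * b) - H (suc n) 2 * b
        + H (suc (suc k)) 1 * (b * b) + H (suc n) 2 * inv (n +ℕ suc (suc k))
        - b * b * tail n

  harmonic-split : H (suc (suc k)) 1 ≡ tail 0 + 1ℚ
  harmonic-split = begin
    H (suc (suc k)) 1                                ≡⟨ sum1-shift (suc k) (λ i → inv i * 1ℚ) ⟨
    sum1 (suc k) (λ i → inv (suc i) * 1ℚ) + 1ℚ * 1ℚ  ≡⟨ cong (_+ 1ℚ) (sum1-cong (suc k) (λ i → *-identityʳ (inv (suc i)))) ⟩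
    tail 0 + 1ℚ                                      ∎

  tail-suc : ∀ n → tail (suc n) ≡ tail n + inv (suc n +ℕ suc (suc k)) - inv (suc (suc n))
  tail-suc n = begin
    tail (suc n)                                   ≡⟨ solve 2 (λ t a → t := t :+ a :- a) refl (tail (suc n)) a ⟩
    tail (suc n) + a - a                           ≡⟨ cong (λ s → s + a - a) (sum1-cong (suc k) (λ i → cong inv (ℕ.+-suc (suc n) i))) ⟨
    sum1 (suc k) (λ i → f (suc i)) + a - a         ≡⟨ cong (λ t → sum1 (suc k) (λ i → f (suc i)) + t - a) (cong inv∘suc (ℕ.+-comm 1 n)) ⟩
    sum1 (suc k) (λ i → f (suc i)) + f 1 - a       ≡⟨ cong (_- a) (sum1-shift (suc k) f) ⟩
    tail n + inv (suc n +ℕ suc (suc k)) - a        ∎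
    where
    a = inv (suc (suc n))
    f = λ i → inv (suc n +ℕ i)
    inv∘suc = λ j → inv (suc j)

  rhs-zero : rhs 0 ≡ 0ℚ
  rhs-zero = begin
    rhs 0
      ≡⟨ cong (λ h → 0ℚ - M * (b * b) - 1ℚ * b + h * (b * b) + 1ℚ * M - b * b * tail 0) harmonic-split ⟩
    0ℚ - M * (b * b) - 1ℚ * b + (tail 0 + 1ℚ) * (b * b) + 1ℚ * M - b * b * tail 0
      ≡⟨ solve 3 (λ t b M → con 0ℚ :- M :* (b :* b) :- con 1ℚ :* b :+ (t :+ con 1ℚ) :* (b :* b) :+ con 1ℚ :* M :- b :* b :* t
                            := con 0ℚ :+ (con 1ℚ :* con 1ℚ :* (M :- b) :- b :* b :* (M :- con 1ℚ)))
                 refl (tail 0) b M ⟩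
    0ℚ + (1ℚ * 1ℚ * (M - b) - b * b * (M - 1ℚ))
      ≡⟨ +-cancel-difference 0ℚ (inv²-partial-fraction 1 (suc k)) ⟩
    0ℚ
      ∎
    where
    M = inv (suc (suc k))

  rhs-suc : ∀ n → rhs (suc n) ≡ rhs n + H (suc n) 2 * inv (suc n +ℕ suc (suc k))
  rhs-suc n = begin
    rhs (suc n)
      ≡⟨ cong₂ (λ o' t → G n (suc k) + h * o' - C - (h + a * (a * 1ℚ)) * b + Hm * (b * b) + (h + a * (a * 1ℚ)) * e - b * b * t)
               (cong inv (ℕ.+-suc n (suc k))) (sym (tail-suc n)) ⟨
    G n (suc k) + h * o - C - (h + a * (a * 1ℚ)) * b + Hm * (b * b) + (h + a * (a * 1ℚ)) * e - b * b * (tail n + e - a)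
      ≡⟨ solve 9 (λ g h o C a b Hm e t →
                    g :+ h :* o :- C :- (h :+ a :* (a :* con 1ℚ)) :* b :+ Hm :* (b :* b) :+ (h :+ a :* (a :* con 1ℚ)) :* e :- b :* b :* (t :+ e :- a)
                    := (g :- C :- h :* b :+ Hm :* (b :* b) :+ h :* o :- b :* b :* t) :+ h :* e :+ (a :* a :* (e :- b) :- b :* b :* (e :- a)))
                 refl (G n (suc k)) h o C a b Hm e (tail n) ⟩
    rhs n + h * e + (a * a * (e - b) - b * b * (e - a))
      ≡⟨ +-cancel-difference (rhs n + h * e) (subst (λ t → a * a * (t - b) ≡ b * b * (t - a)) e-shift (inv²-partial-fraction (suc (suc n)) (suc k))) ⟩
    rhs n + h * e
      ∎
    where
    h = H (suc n) 2
    a = inv (suc (suc n))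
    o = inv (n +ℕ suc (suc k))
    e = inv (suc n +ℕ suc (suc k))
    C = inv (suc (suc k)) * (b * b)
    Hm = H (suc (suc k)) 1
    e-shift : inv (suc (suc n) +ℕ suc k) ≡ e
    e-shift = cong (λ j → inv (suc j)) (sym (ℕ.+-suc n (suc k)))

  G-recurrence : ∀ n → G n (suc (suc k)) ≡ rhs n
  G-recurrence = sum1-unique rhs (λ j → H j 2 * inv (j +ℕ suc (suc k))) rhs-zero rhs-suc

  inv-b² : inv (suc k *ℕ suc k) ≡ b * b
  inv-b² = inv-* (suc k) (suc k)

  inv-C : inv (suc (suc k) *ℕ (suc k *ℕ suc k)) ≡ inv (suc (suc k)) * (b * b)
  inv-C = trans (inv-* (suc (suc k)) (suc k *ℕ suc k)) (cong (inv (suc (suc k)) *_) inv-b²)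

  tail-as-sumFromTo : ∀ n → sumFromTo (n +ℕ 2) (n +ℕ suc (suc k)) inv ≡ tail n
  tail-as-sumFromTo n =
    trans (cong₂ (λ p q → sumFromTo p q inv) (ℕ.+-comm n 2) (ℕ.+-suc n (suc k)))
          (sumFromTo-suc (suc n) (suc k) inv)

  rhs-as-stated : ∀ n → rhs n ≡ G n (suc k)
                             - inv (suc (suc k) *ℕ (suc k *ℕ suc k))
                             - H (n +ℕ 1) 2 * inv (suc k)
                             + H (suc (suc k)) 1 * inv (suc k *ℕ suc k)
                             + H (n +ℕ 1) 2 * inv (n +ℕ suc (suc k))
                             - inv (suc k *ℕ suc k) * sumFromTo (n +ℕ 2) (n +ℕ suc (suc k)) inv
  rhs-as-stated n = begin
    rhs n
      ≡⟨ cong₂ (λ c q → Φ c q (H (suc n) 2) (tail n)) inv-C inv-b² ⟨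
    Φ C (inv (suc k *ℕ suc k)) (H (suc n) 2) (tail n)
      ≡⟨ cong₂ (Φ C (inv (suc k *ℕ suc k))) (cong (λ j → H j 2) (ℕ.+-comm 1 n)) (sym (tail-as-sumFromTo n)) ⟩
    Φ C (inv (suc k *ℕ suc k)) (H (n +ℕ 1) 2) (sumFromTo (n +ℕ 2) (n +ℕ suc (suc k)) inv) ∎
    where
    C = inv (suc (suc k) *ℕ (suc k *ℕ suc k))
    Φ : ℚ → ℚ → ℚ → ℚ → ℚ
    Φ c q h s = G n (suc k) - c - h * b + H (suc (suc k)) 1 * q + h * inv (n +ℕ suc (suc k)) - q * s

module AtOne where

  rhs : ℕ → ℚ
  rhs n = H (suc n) 1 * H (suc n) 2 - sum1 (suc n) (λ j → H j 1 * invPow j 2)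

  rhs-suc : ∀ n → rhs (suc n) ≡ rhs n + H (suc n) 2 * inv (suc n +ℕ 1)
  rhs-suc n = begin
    (h₁ + a * 1ℚ) * (h₂ + a * (a * 1ℚ)) - (S + (h₁ + a * 1ℚ) * (a * (a * 1ℚ)))
      ≡⟨ solve 4 (λ h₁ h₂ S a → (h₁ :+ a :* con 1ℚ) :* (h₂ :+ a :* (a :* con 1ℚ)) :- (S :+ (h₁ :+ a :* con 1ℚ) :* (a :* (a :* con 1ℚ)))
                                := (h₁ :* h₂ :- S) :+ h₂ :* a) refl h₁ h₂ S a ⟩
    rhs n + h₂ * a
      ≡⟨ cong (λ j → rhs n + h₂ * inv (suc j)) (ℕ.+-comm 1 n) ⟩
    rhs n + h₂ * inv (suc n +ℕ 1) ∎
    where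
    h₁ = H (suc n) 1
    h₂ = H (suc n) 2
    S = sum1 (suc n) (λ j → H j 1 * invPow j 2)
    a = inv (suc (suc n))

  G-at-one : ∀ n → G n 1 ≡ H (n +ℕ 1) 1 * H (n +ℕ 1) 2 - sum1 (n +ℕ 1) (λ j → H j 1 * invPow j 2)
  G-at-one n =
    trans (sum1-unique rhs (λ j → H j 2 * inv (j +ℕ 1)) refl rhs-suc n)
          (cong (λ j → H j 1 * H j 2 - sum1 j (λ i → H i 1 * invPow i 2)) (ℕ.+-comm 1 n))

lemma3 : (∀ (n m : ℕ) → 1 ≤ n → 1 < m →
           G n m ≡ G n (m ∸ 1)
                   - inv (m *ℕ ((m ∸ 1) *ℕ (m ∸ 1)))
                   - H (n +ℕ 1) 2 * inv (m ∸ 1)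
                   + H m 1 * inv ((m ∸ 1) *ℕ (m ∸ 1))
                   + H (n +ℕ 1) 2 * inv (n +ℕ m)
                   - inv ((m ∸ 1) *ℕ (m ∸ 1))
                     * sumFromTo (n +ℕ 2) (n +ℕ m) inv)
         × (∀ (n : ℕ) → 1 ≤ n →
           (G n 1 ≡ sum1 n (λ j → H j 2 * inv (j +ℕ 1)))
           × (G n 1 ≡ H (n +ℕ 1) 1 * H (n +ℕ 1) 2
                      - sum1 (n +ℕ 1) (λ j → H j 1 * invPow j 2)))
lemma3 = (λ { n (suc (suc k)) _ (s≤s (s≤s z≤n)) →
                trans (Recurrence.G-recurrence k n) (Recurrence.rhs-as-stated k n) })
       , λ n _ → refl , AtOne.G-at-one n
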